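{- For all integers $k\ge 2$ and all positive integers $n,m$, $$\mathrm{HB2}_k(n,m)\le mn-\sqrt{\frac{2k}{k-1}\,(2nm-n-m)}.$$
   Context: A two-dimensional partial word of size $n$ by $m$ over an alphabet $A$ is a map $w:\{0,\dots,n-1\}\times\{0,\dots,m-1\}\to A\cup\{\diamondsuit\}$, where $\diamondsuit\notin A$ is a hole; its domain $\mathrm{D}(w)$ is the set of positions $p$ with $w(p)\in A$. An $(n,m)$-ruler is a subset $R\subseteq\{0,\dots,n-1\}\times\{0,\dots,m-1\}$ such that every $(x,y)\in\mathbb{Z}^2$ with $|x|\le n-1$, $|y|\le m-1$ equals $r_1-r_2$ for some $r_1,r_2\in R$. The two-dimensional partial word $w$ is unbordered if $\mathrm{D}(w)$ is an $(n,m)$-ruler and for every nonzero vector $v$ with $|v_1|\le n-1$, $|v_2|\le m-1$ there exist $r_1,r_2\in\mathrm{D}(w)$ with $r_1-r_2=v$ and $w(r_1)\ne w(r_2)$. $\mathrm{HB2}_k(n,m)$ denotes the maximum number of holes an $n$ by $m$ unbordered two-dimensional partial word over an alphabet of size $k$ can have. -}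

module Defs where

open import Data.Nat as ℕ using (ℕ; zero; suc)
open import Data.Integer as ℤ using (ℤ; +_; _-_; ∣_∣)
open import Data.Fin using (Fin; toℕ)
open import Data.Maybe using (Maybe; just; nothing)
open import Data.Product using (_×_; _,_; ∃; ∃-syntax; Σ-syntax)
open import Relation.Binary.PropositionalEquality using (_≡_; _≢_)
open import Relation.Nullary using (¬_)

-- A two-dimensional partial word of size n by m over the alphabet Fin k:
-- position (i , j) holds  just a  (a letter) or  nothing  (a hole ◇).
PWord : ℕ → ℕ → ℕ → Set
PWord k n m = Fin n → Fin m → Maybe (Fin k)

InDom : ∀ {k n m} → PWord k n m → Fin n → Fin m → Set
InDom w i j = ∃[ a ] (w i j ≡ just a)

Diff : ∀ {n m} → Fin n → Fin m → Fin n → Fin m → ℤ → ℤ → Set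
Diff i₁ j₁ i₂ j₂ x y =
  ((+ toℕ i₁) - (+ toℕ i₂) ≡ x) × ((+ toℕ j₁) - (+ toℕ j₂) ≡ y)

IsRuler : ∀ {k n m} → PWord k n m → Set
IsRuler {k} {n} {m} w =
  (x y : ℤ) → ∣ x ∣ ℕ.≤ n ℕ.∸ 1 → ∣ y ∣ ℕ.≤ m ℕ.∸ 1 →
  ∃[ i₁ ] ∃[ j₁ ] ∃[ i₂ ] ∃[ j₂ ]
    (InDom w i₁ j₁ × InDom w i₂ j₂ × Diff i₁ j₁ i₂ j₂ x y)

Unbordered : ∀ {k n m} → PWord k n m → Set
Unbordered {k} {n} {m} w =
  IsRuler w ×
  ((x y : ℤ) → ∣ x ∣ ℕ.≤ n ℕ.∸ 1 → ∣ y ∣ ℕ.≤ m ℕ.∸ 1 →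
    ¬ ((x ≡ + 0) × (y ≡ + 0)) →
    ∃[ i₁ ] ∃[ j₁ ] ∃[ i₂ ] ∃[ j₂ ]
      (InDom w i₁ j₁ × InDom w i₂ j₂ × Diff i₁ j₁ i₂ j₂ x y ×
       w i₁ j₁ ≢ w i₂ j₂))

sumFin : (n : ℕ) → (Fin n → ℕ) → ℕ
sumFin zero f = 0
sumFin (suc n) f = f Fin.zero ℕ.+ sumFin n (λ i → f (Fin.suc i))

isHole : ∀ {k} → Maybe (Fin k) → ℕ
isHole nothing = 1
isHole (just _) = 0

holes : ∀ {k n m} → PWord k n m → ℕ
holes {k} {n} {m} w = sumFin n (λ i → sumFin m (λ j → isHole (w i j)))

{-# OPTIONS --safe #-}
module Submission where

-- Let d = nm − holes be the number of letters and c_a the number of occurrences of the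
-- letter a, so d = Σ c_a. In an unbordered word every nonzero vector of the
-- (2n − 1) × (2m − 1) box of shifts is the offset of an ordered pair of domain positions
-- carrying different letters, so there are at least (2n − 1)(2m − 1) − 1 = 2(2nm − n − m)
-- such pairs. There are exactly d² − Σ c_a² of them, and Cauchy–Schwarz, d² ≤ k Σ c_a²,
-- bounds this by (k − 1) d² / k.

open import Defs
open import Data.Nat using (ℕ; zero; suc; _+_; _*_; _∸_; _^_; _≤_; z≤n)
open import Data.Nat.Properties hiding (_≟_)
open import Algebra.Properties.CommutativeSemigroup +-commutativeSemigroup
  using () renaming (interchange to +-interchange)
open import Data.Nat.ListAction using (sum)
open import Data.Nat.Tactic.RingSolver using (solve-∀)
open import Data.Bool using (if_then_else_)
open import Data.Fin using (Fin; zero; suc; toℕ)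
open import Data.Fin.Properties using (_≟_; injective⇒≤)
open import Data.Integer as ℤ using (ℤ; -[1+_]; ∣_∣)
open import Data.Maybe using (Maybe; just; nothing)
import Data.Maybe as Maybe
open import Data.List
  using (List; []; _∷_; _++_; length; lookup; map; filter; concat; tabulate; fromMaybe; cartesianProduct)
open import Data.List.Properties using (length-++; length-map; filter-++)
open import Data.List.Membership.Propositional using (_∈_)
open import Data.List.Membership.Propositional.Properties
  using (∈-lookup; ∈-map⁺; ∈-filter⁺; ∈-concat⁺′; ∈-tabulate⁺; ∈-cartesianProduct⁺; ∈-cartesianProduct⁻)
open import Data.List.Relation.Binary.Subset.Propositional using (_⊆_)
open import Data.List.Relation.Unary.Any using (here; there; index)
open import Data.List.Relation.Unary.Any.Properties using (lookup-index)
open import Data.List.Relation.Unary.All as All using (All; []; _∷_)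
open import Data.List.Relation.Unary.AllPairs using ([]; _∷_)
open import Data.List.Relation.Unary.Unique.Propositional using (Unique)
open import Data.List.Relation.Unary.Unique.Propositional.Properties using (cartesianProduct⁺)
open import Data.Product using (_×_; _,_; uncurry)
open import Data.Product.Properties using (≡-dec)
open import Data.Sum using (inj₁; inj₂)
open import Function using (_∘_)
open import Relation.Binary.PropositionalEquality
open import Relation.Nullary using (Dec; does; yes; no; ¬?; contradiction)
open import Relation.Unary using (Decidable)

module _ {A : Set} where

  lookup-injective : ∀ {xs : List A} → Unique xs → ∀ {i j} → lookup xs i ≡ lookup xs j → i ≡ j
  lookup-injective (_  ∷ _) {zero}  {zero}  _  = refl
  lookup-injective (x∉ ∷ _) {zero}  {suc j} eq = contradiction eq (All.lookup x∉ (∈-lookup j))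
  lookup-injective (x∉ ∷ _) {suc i} {zero}  eq = contradiction (sym eq) (All.lookup x∉ (∈-lookup i))
  lookup-injective (_  ∷ u) {suc i} {suc j} eq = cong suc (lookup-injective u eq)

  unique-⊆⇒length≤ : ∀ {xs ys : List A} → Unique xs → xs ⊆ ys → length xs ≤ length ys
  unique-⊆⇒length≤ {xs} {ys} u xs⊆ys = injective⇒≤ position-injective
    where
    position : Fin (length xs) → Fin (length ys)
    position i = index (xs⊆ys (∈-lookup i))

    position-injective : ∀ {i j} → position i ≡ position j → i ≡ j
    position-injective {i} {j} eq = lookup-injective u (begin
      lookup xs i                ≡⟨ lookup-index (xs⊆ys (∈-lookup i)) ⟩
      lookup ys (position i)     ≡⟨ cong (lookup ys) eq ⟩
      lookup ys (position j)     ≡⟨ lookup-index (xs⊆ys (∈-lookup j)) ⟨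
      lookup xs j                ∎)
      where open ≡-Reasoning

length-cartesianProduct : ∀ {A B : Set} (xs : List A) (ys : List B) →
  length (cartesianProduct xs ys) ≡ length xs * length ys
length-cartesianProduct []       ys = refl
length-cartesianProduct (x ∷ xs) ys = begin
  length (map (x ,_) ys ++ cartesianProduct xs ys)          ≡⟨ length-++ (map (x ,_) ys) ⟩
  length (map (x ,_) ys) + length (cartesianProduct xs ys)  ≡⟨ cong₂ _+_ (length-map (x ,_) ys) (length-cartesianProduct xs ys) ⟩
  length ys + length xs * length ys                         ∎
  where open ≡-Reasoning

-- Defined through does, so that indicator (suc a ≟ suc b) computes to indicator (a ≟ b).
indicator : ∀ {P : Set} → Dec P → ℕ
indicator P? = if does P? then 1 else 0

sumFin-cong : ∀ n {f g : Fin n → ℕ} → (∀ i → f i ≡ g i) → sumFin n f ≡ sumFin n g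
sumFin-cong zero    f≗g = refl
sumFin-cong (suc n) f≗g = cong₂ _+_ (f≗g zero) (sumFin-cong n (f≗g ∘ suc))

sumFin-distrib-+ : ∀ n (f g : Fin n → ℕ) → sumFin n (λ i → f i + g i) ≡ sumFin n f + sumFin n g
sumFin-distrib-+ zero    f g = refl
sumFin-distrib-+ (suc n) f g = begin
  f zero + g zero + sumFin n (λ i → f (suc i) + g (suc i))
    ≡⟨ cong (f zero + g zero +_) (sumFin-distrib-+ n (f ∘ suc) (g ∘ suc)) ⟩
  f zero + g zero + (sumFin n (f ∘ suc) + sumFin n (g ∘ suc))
    ≡⟨ +-interchange (f zero) (g zero) _ _ ⟩
  f zero + sumFin n (f ∘ suc) + (g zero + sumFin n (g ∘ suc)) ∎
  where open ≡-Reasoning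

sumFin-const : ∀ n c → sumFin n (λ _ → c) ≡ n * c
sumFin-const zero    c = refl
sumFin-const (suc n) c = cong (c +_) (sumFin-const n c)

sumFin-indicator : ∀ {k} (b : Fin k) (g : Fin k → ℕ) →
  sumFin k (λ a → indicator (a ≟ b) * g a) ≡ g b
sumFin-indicator {suc k} zero    g = begin
  g zero + 0 + sumFin k (λ _ → 0)  ≡⟨ cong₂ _+_ (+-identityʳ (g zero)) (sumFin-const k 0) ⟩
  g zero + k * 0                   ≡⟨ cong (g zero +_) (*-zeroʳ k) ⟩
  g zero + 0                       ≡⟨ +-identityʳ (g zero) ⟩
  g zero                           ∎
  where open ≡-Reasoning
sumFin-indicator {suc k} (suc b) g = sumFin-indicator b (g ∘ suc)

2*m*n≤m*m+n*n : ∀ m n → 2 * (m * n) ≤ m * m + n * n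
2*m*n≤m*m+n*n m n with ≤-total m n
... | inj₁ m≤n with t , refl ← m≤n⇒∃[o]m+o≡n m≤n =
  subst (2 * (m * (m + t)) ≤_) (sym (gap m t)) (m≤m+n _ (t * t))
  where
  gap : ∀ m t → m * m + (m + t) * (m + t) ≡ 2 * (m * (m + t)) + t * t
  gap = solve-∀
... | inj₂ n≤m with t , refl ← m≤n⇒∃[o]m+o≡n n≤m =
  subst (2 * ((n + t) * n) ≤_) (sym (gap n t)) (m≤m+n _ (t * t))
  where
  gap : ∀ n t → (n + t) * (n + t) + n * n ≡ 2 * ((n + t) * n) + t * t
  gap = solve-∀

2*x*sumFin≤ : ∀ k (c : Fin k → ℕ) x →
  2 * (x * sumFin k c) ≤ k * (x * x) + sumFin k (λ a → c a * c a)
2*x*sumFin≤ zero    c x = ≤-reflexive (cong (2 *_) (*-zeroʳ x))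
2*x*sumFin≤ (suc k) c x = begin
  2 * (x * (y + s))                      ≡⟨ distrib x y s ⟩
  2 * (x * y) + 2 * (x * s)              ≤⟨ +-mono-≤ (2*m*n≤m*m+n*n x y) (2*x*sumFin≤ k (c ∘ suc) x) ⟩
  (x * x + y * y) + (k * (x * x) + q)    ≡⟨ regroup x y k q ⟩
  suc k * (x * x) + (y * y + q)          ∎
  where
  open ≤-Reasoning
  y = c zero
  s = sumFin k (c ∘ suc)
  q = sumFin k (λ a → c (suc a) * c (suc a))
  distrib : ∀ x y s → 2 * (x * (y + s)) ≡ 2 * (x * y) + 2 * (x * s)
  distrib = solve-∀
  regroup : ∀ x y k q → (x * x + y * y) + (k * (x * x) + q) ≡ suc k * (x * x) + (y * y + q)
  regroup = solve-∀

sumFin-cauchy-schwarz : ∀ k (c : Fin k → ℕ) →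
  sumFin k c * sumFin k c ≤ k * sumFin k (λ a → c a * c a)
sumFin-cauchy-schwarz zero    c = z≤n
sumFin-cauchy-schwarz (suc k) c = begin
  (x + s) * (x + s)                    ≡⟨ expand x s ⟩
  x * x + 2 * (x * s) + s * s          ≤⟨ +-mono-≤ (+-monoʳ-≤ (x * x) (2*x*sumFin≤ k (c ∘ suc) x))
                                                   (sumFin-cauchy-schwarz k (c ∘ suc)) ⟩
  x * x + (k * (x * x) + q) + k * q    ≡⟨ regroup x k q ⟩
  suc k * (x * x + q)                  ∎
  where
  open ≤-Reasoning
  x = c zero
  s = sumFin k (c ∘ suc)
  q = sumFin k (λ a → c (suc a) * c (suc a))
  expand : ∀ x s → (x + s) * (x + s) ≡ x * x + 2 * (x * s) + s * s
  expand = solve-∀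
  regroup : ∀ x k q → x * x + (k * (x * x) + q) + k * q ≡ suc k * (x * x + q)
  regroup = solve-∀

module Colouring {A : Set} {k : ℕ} (colour : A → Fin k) where

  multiplicity : List A → Fin k → ℕ
  multiplicity []       a = 0
  multiplicity (x ∷ xs) a = indicator (a ≟ colour x) + multiplicity xs a

  sum-map-colour : ∀ (g : Fin k → ℕ) xs →
    sum (map (g ∘ colour) xs) ≡ sumFin k (λ a → multiplicity xs a * g a)
  sum-map-colour g []       = sym (trans (sumFin-const k 0) (*-zeroʳ k))
  sum-map-colour g (x ∷ xs) = sym (begin
    sumFin k (λ a → (δ a + multiplicity xs a) * g a)
      ≡⟨ sumFin-cong k (λ a → *-distribʳ-+ (g a) (δ a) (multiplicity xs a)) ⟩
    sumFin k (λ a → δ a * g a + multiplicity xs a * g a)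
      ≡⟨ sumFin-distrib-+ k _ _ ⟩
    sumFin k (λ a → δ a * g a) + sumFin k (λ a → multiplicity xs a * g a)
      ≡⟨ cong₂ _+_ (sumFin-indicator (colour x) g) (sym (sum-map-colour g xs)) ⟩
    g (colour x) + sum (map (g ∘ colour) xs) ∎)
    where
    open ≡-Reasoning
    δ : Fin k → ℕ
    δ a = indicator (a ≟ colour x)

  length≡sumFin-multiplicity : ∀ xs → length xs ≡ sumFin k (multiplicity xs)
  length≡sumFin-multiplicity xs = begin
    length xs                                    ≡⟨ sum-map-1 xs ⟨
    sum (map (λ _ → 1) xs)                       ≡⟨ sum-map-colour (λ _ → 1) xs ⟩
    sumFin k (λ a → multiplicity xs a * 1)       ≡⟨ sumFin-cong k (λ a → *-identityʳ (multiplicity xs a)) ⟩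
    sumFin k (multiplicity xs)                   ∎
    where
    open ≡-Reasoning
    sum-map-1 : ∀ (ys : List A) → sum (map (λ _ → 1) ys) ≡ length ys
    sum-map-1 []       = refl
    sum-map-1 (_ ∷ ys) = cong suc (sum-map-1 ys)

  heterochromatic? : Decidable {A = A × A} (λ (x , y) → colour x ≢ colour y)
  heterochromatic? (x , y) = ¬? (colour x ≟ colour y)

  heteroPairs : List A → List A → List (A × A)
  heteroPairs xs ys = filter heterochromatic? (cartesianProduct xs ys)

  ∈-heteroPairs : ∀ {x y xs ys} → x ∈ xs → y ∈ ys → colour x ≢ colour y → (x , y) ∈ heteroPairs xs ys
  ∈-heteroPairs x∈xs y∈ys x≢y = ∈-filter⁺ heterochromatic? (∈-cartesianProduct⁺ x∈xs y∈ys) x≢y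

  length-heteroPairs-row : ∀ x ys →
    length (filter heterochromatic? (map (x ,_) ys)) + multiplicity ys (colour x) ≡ length ys
  length-heteroPairs-row x []       = refl
  length-heteroPairs-row x (y ∷ ys) with colour x ≟ colour y
  ... | yes _ = trans (+-suc _ _) (cong suc (length-heteroPairs-row x ys))
  ... | no  _ = cong suc (length-heteroPairs-row x ys)

  length-heteroPairs : ∀ xs ys →
    length (heteroPairs xs ys) + sum (map (λ x → multiplicity ys (colour x)) xs) ≡ length xs * length ys
  length-heteroPairs []       ys = refl
  length-heteroPairs (x ∷ xs) ys = begin
    length (filter heterochromatic? (row ++ cartesianProduct xs ys)) + (μ x + S)
      ≡⟨ cong (λ l → length l + (μ x + S)) (filter-++ heterochromatic? row (cartesianProduct xs ys)) ⟩
    length (filter heterochromatic? row ++ heteroPairs xs ys) + (μ x + S)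
      ≡⟨ cong (_+ (μ x + S)) (length-++ (filter heterochromatic? row)) ⟩
    length (filter heterochromatic? row) + length (heteroPairs xs ys) + (μ x + S)
      ≡⟨ +-interchange (length (filter heterochromatic? row)) _ _ _ ⟩
    length (filter heterochromatic? row) + μ x + (length (heteroPairs xs ys) + S)
      ≡⟨ cong₂ _+_ (length-heteroPairs-row x ys) (length-heteroPairs xs ys) ⟩
    length ys + length xs * length ys ∎
    where
    open ≡-Reasoning
    row = map (x ,_) ys
    μ : A → ℕ
    μ z = multiplicity ys (colour z)
    S = sum (map μ xs)

  heteroPairs-bound : ∀ xs → k * length (heteroPairs xs xs) ≤ (k ∸ 1) * (length xs * length xs)
  heteroPairs-bound xs = begin
    k * H                   ≡⟨ m+n∸n≡m (k * H) (d * d) ⟨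
    k * H + d * d ∸ d * d   ≤⟨ ∸-monoˡ-≤ (d * d) (+-monoʳ-≤ (k * H) d*d≤k*S) ⟩
    k * H + k * S ∸ d * d   ≡⟨ cong (_∸ d * d) k*H+k*S≡k*d*d ⟩
    k * (d * d) ∸ d * d     ≡⟨ cong (k * (d * d) ∸_) (+-identityʳ (d * d)) ⟨
    k * (d * d) ∸ 1 * (d * d) ≡⟨ *-distribʳ-∸ (d * d) k 1 ⟨
    (k ∸ 1) * (d * d)       ∎
    where
    open ≤-Reasoning
    d = length xs
    H = length (heteroPairs xs xs)
    S = sumFin k (λ a → multiplicity xs a * multiplicity xs a)

    d*d≤k*S : d * d ≤ k * S
    d*d≤k*S = subst (λ l → l * l ≤ k * S) (sym (length≡sumFin-multiplicity xs))
                (sumFin-cauchy-schwarz k (multiplicity xs))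

    k*H+k*S≡k*d*d : k * H + k * S ≡ k * (d * d)
    k*H+k*S≡k*d*d = trans (sym (*-distribˡ-+ k H S)) (cong (k *_) (begin-equality
      H + S                                    ≡⟨ cong (H +_) (sum-map-colour (multiplicity xs) xs) ⟨
      H + sum (map (multiplicity xs ∘ colour) xs) ≡⟨ length-heteroPairs xs xs ⟩
      d * d                                    ∎))

length-concat-tabulate : ∀ {A : Set} n (f : Fin n → List A) →
  length (concat (tabulate f)) ≡ sumFin n (length ∘ f)
length-concat-tabulate zero    f = refl
length-concat-tabulate (suc n) f =
  trans (length-++ (f zero)) (cong (length (f zero) +_) (length-concat-tabulate n (f ∘ suc)))

∈-concat-tabulate : ∀ {A : Set} {n} (f : Fin n → List A) i {x} → x ∈ f i → x ∈ concat (tabulate f)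
∈-concat-tabulate f i x∈ = ∈-concat⁺′ x∈ (∈-tabulate⁺ i)

Entry : ℕ → ℕ → ℕ → Set
Entry k n m = Fin n × Fin m × Fin k

letter : ∀ {k n m} → Entry k n m → Fin k
letter (_ , _ , a) = a

offset : ∀ {k n m} → Entry k n m → Entry k n m → ℤ × ℤ
offset (i₁ , j₁ , _) (i₂ , j₂ , _) = (ℤ.+ toℕ i₁ ℤ.- ℤ.+ toℕ i₂) , (ℤ.+ toℕ j₁ ℤ.- ℤ.+ toℕ j₂)

entry : ∀ {k n m} → PWord k n m → Fin n → Fin m → Maybe (Entry k n m)
entry w i j = Maybe.map (λ a → i , j , a) (w i j)

entries : ∀ {k n m} → PWord k n m → List (Entry k n m)
entries w = concat (tabulate λ i → concat (tabulate λ j → fromMaybe (entry w i j)))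

∈-entries : ∀ {k n m} (w : PWord k n m) {i j a} → w i j ≡ just a → (i , j , a) ∈ entries w
∈-entries w {i} {j} wij≡a = ∈-concat-tabulate _ i (∈-concat-tabulate _ j
  (subst (λ c → (i , j , _) ∈ fromMaybe (Maybe.map (λ a → i , j , a) c)) (sym wij≡a) (here refl)))

holes+length-entries : ∀ {k n m} (w : PWord k n m) → holes w + length (entries w) ≡ n * m
holes+length-entries {k} {n} {m} w = begin
  holes w + length (entries w)
    ≡⟨ cong (holes w +_) (trans (length-concat-tabulate n _)
                                (sumFin-cong n λ i → length-concat-tabulate m _)) ⟩
  sumFin n (λ i → sumFin m (isHole ∘ w i)) + sumFin n (λ i → sumFin m (λ j → cellLength i j))
    ≡⟨ sumFin-distrib-+ n _ _ ⟨
  sumFin n (λ i → sumFin m (isHole ∘ w i) + sumFin m (λ j → cellLength i j))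
    ≡⟨ sumFin-cong n (λ i → sumFin-distrib-+ m _ _) ⟨
  sumFin n (λ i → sumFin m (λ j → isHole (w i j) + cellLength i j))
    ≡⟨ sumFin-cong n (λ i → sumFin-cong m (λ j → isHole+cellLength (w i j))) ⟩
  sumFin n (λ _ → sumFin m (λ _ → 1))
    ≡⟨ sumFin-cong n (λ _ → trans (sumFin-const m 1) (*-identityʳ m)) ⟩
  sumFin n (λ _ → m)
    ≡⟨ sumFin-const n m ⟩
  n * m ∎
  where
  open ≡-Reasoning
  cellLength : Fin n → Fin m → ℕ
  cellLength i j = length (fromMaybe (entry w i j))
  isHole+cellLength : ∀ {i : Fin n} {j : Fin m} (c : Maybe (Fin k)) →
    isHole c + length (fromMaybe (Maybe.map (λ a → i , j , a) c)) ≡ 1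
  isHole+cellLength nothing  = refl
  isHole+cellLength (just _) = refl

length-entries : ∀ {k n m} (w : PWord k n m) → length (entries w) ≡ n * m ∸ holes w
length-entries w = trans (sym (m+n∸m≡n (holes w) _)) (cong (_∸ holes w) (holes+length-entries w))

symRange : ℕ → List ℤ
symRange zero    = ℤ.+ 0 ∷ []
symRange (suc t) = ℤ.+ suc t ∷ -[1+ t ] ∷ symRange t

symRange-bounded : ∀ t → All (λ x → ∣ x ∣ ≤ t) (symRange t)
symRange-bounded zero    = z≤n ∷ []
symRange-bounded (suc t) = ≤-refl ∷ ≤-refl ∷ All.map m≤n⇒m≤1+n (symRange-bounded t)

symRange-unique : ∀ t → Unique (symRange t)
symRange-unique zero    = [] ∷ []
symRange-unique (suc t) =
  ((λ ()) ∷ All.map (outside refl) (symRange-bounded t)) ∷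
  All.map (outside refl) (symRange-bounded t) ∷
  symRange-unique t
  where
  outside : ∀ {x y} → ∣ x ∣ ≡ suc t → ∣ y ∣ ≤ t → x ≢ y
  outside ∣x∣≡1+t ∣y∣≤t refl = 1+n≰n (subst (_≤ t) ∣x∣≡1+t ∣y∣≤t)

length-symRange : ∀ t → length (symRange t) ≡ suc (2 * t)
length-symRange zero    = refl
length-symRange (suc t) = trans (cong (2 +_) (length-symRange t)) (cong suc (sym (*-suc 2 t)))

box : ℕ → ℕ → List (ℤ × ℤ)
box a b = cartesianProduct (symRange a) (symRange b)

box-unique : ∀ a b → Unique (box a b)
box-unique a b = cartesianProduct⁺ (symRange-unique a) (symRange-unique b)

length-box : ∀ a b → length (box a b) ≡ suc (2 * (2 * suc a * suc b ∸ suc a ∸ suc b))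
length-box a b = begin
  length (box a b)                                   ≡⟨ length-cartesianProduct (symRange a) (symRange b) ⟩
  length (symRange a) * length (symRange b)          ≡⟨ cong₂ _*_ (length-symRange a) (length-symRange b) ⟩
  suc (2 * a) * suc (2 * b)                          ≡⟨ expand a b ⟩
  suc (2 * T)                                        ≡⟨ cong (λ t → suc (2 * t)) T≡ ⟨
  suc (2 * (2 * suc a * suc b ∸ suc a ∸ suc b))      ∎
  where
  open ≡-Reasoning
  T = 2 * a * b + a + b
  expand : ∀ a b → suc (2 * a) * suc (2 * b) ≡ suc (2 * (2 * a * b + a + b))
  expand = solve-∀
  split : ∀ a b → 2 * suc a * suc b ≡ (2 * a * b + a + b) + suc b + suc a
  split = solve-∀
  T≡ : 2 * suc a * suc b ∸ suc a ∸ suc b ≡ T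
  T≡ = begin
    2 * suc a * suc b ∸ suc a ∸ suc b        ≡⟨ cong (λ x → x ∸ suc a ∸ suc b) (split a b) ⟩
    T + suc b + suc a ∸ suc a ∸ suc b        ≡⟨ cong (_∸ suc b) (m+n∸n≡m (T + suc b) (suc a)) ⟩
    T + suc b ∸ suc b                        ≡⟨ m+n∸n≡m T (suc b) ⟩
    T                                        ∎

open Colouring using (heteroPairs; ∈-heteroPairs; heteroPairs-bound)

mismatchedPairs : ∀ {k n m} → PWord k n m → List (Entry k n m × Entry k n m)
mismatchedPairs w = heteroPairs letter (entries w) (entries w)

unbordered⇒box⊆ : ∀ {k a b} (w : PWord k (suc a) (suc b)) → Unbordered w →
  box a b ⊆ (ℤ.+ 0 , ℤ.+ 0) ∷ map (uncurry offset) (mismatchedPairs w)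
unbordered⇒box⊆ {a = a} {b} w (_ , separated) {x , y} v∈box
  with ≡-dec ℤ._≟_ ℤ._≟_ (x , y) (ℤ.+ 0 , ℤ.+ 0)
... | yes v≡0 = here v≡0
... | no  v≢0
  with x∈ , y∈ ← ∈-cartesianProduct⁻ (symRange a) (symRange b) v∈box
  with i₁ , j₁ , i₂ , j₂ , (a₁ , w₁) , (a₂ , w₂) , (dx , dy) , w₁≢w₂
         ← separated x y (All.lookup (symRange-bounded a) x∈) (All.lookup (symRange-bounded b) y∈)
                         (λ (x≡0 , y≡0) → v≢0 (cong₂ _,_ x≡0 y≡0))
  = there (subst (_∈ map (uncurry offset) (mismatchedPairs w)) (cong₂ _,_ dx dy)
      (∈-map⁺ (uncurry offset) (∈-heteroPairs letter (∈-entries w w₁) (∈-entries w w₂) a₁≢a₂)))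
  where
  a₁≢a₂ : a₁ ≢ a₂
  a₁≢a₂ a₁≡a₂ = w₁≢w₂ (trans w₁ (trans (cong just a₁≡a₂) (sym w₂)))

unbordered⇒length-mismatchedPairs≥ : ∀ {k a b} (w : PWord k (suc a) (suc b)) → Unbordered w →
  2 * (2 * suc a * suc b ∸ suc a ∸ suc b) ≤ length (mismatchedPairs w)
unbordered⇒length-mismatchedPairs≥ {a = a} {b} w unbordered = ≤-pred (begin
  suc (2 * (2 * suc a * suc b ∸ suc a ∸ suc b))          ≡⟨ length-box a b ⟨
  length (box a b)                                       ≤⟨ unique-⊆⇒length≤ (box-unique a b) (unbordered⇒box⊆ w unbordered) ⟩
  suc (length (map (uncurry offset) (mismatchedPairs w)))  ≡⟨ cong suc (length-map (uncurry offset) (mismatchedPairs w)) ⟩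
  suc (length (mismatchedPairs w))                       ∎)
  where open ≤-Reasoning

theorem13 : (k n m : ℕ) → 2 ≤ k → 1 ≤ n → 1 ≤ m →
    (w : PWord k n m) → Unbordered w →
    2 * k * (2 * n * m ∸ n ∸ m) ≤ (k ∸ 1) * ((m * n ∸ holes w) ^ 2)
theorem13 k n@(suc _) m@(suc _) _ _ _ w unbordered = begin
  2 * k * T                          ≡⟨ cong (_* T) (*-comm 2 k) ⟩
  k * 2 * T                          ≡⟨ *-assoc k 2 T ⟩
  k * (2 * T)                        ≤⟨ *-monoʳ-≤ k (unbordered⇒length-mismatchedPairs≥ w unbordered) ⟩
  k * length (mismatchedPairs w)     ≤⟨ heteroPairs-bound letter (entries w) ⟩
  (k ∸ 1) * (d * d)                  ≡⟨ cong ((k ∸ 1) *_) (sym square≡d*d) ⟩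
  (k ∸ 1) * ((m * n ∸ holes w) ^ 2)  ∎
  where
  open ≤-Reasoning
  T = 2 * n * m ∸ n ∸ m
  d = length (entries w)
  d≡ : d ≡ m * n ∸ holes w
  d≡ = trans (length-entries w) (cong (_∸ holes w) (*-comm n m))
  square≡d*d : (m * n ∸ holes w) ^ 2 ≡ d * d
  square≡d*d = subst (λ e → e ^ 2 ≡ d * d) d≡ (cong (d *_) (*-identityʳ d))
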